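{- Let $w\geqslant 2$ and $h=2^d$ with $d\in\mathbb{N}$. Then $r(\mathcal{H}_{h,w})=h$.
   Context: An image of height $h$ and width $w\geqslant 2$ consists of pixels $p_{ij}$, $i=0,\dots,h-1$ (row, counted from the bottom), $j=0,\dots,w-1$ (column). For a set $T$ of pixels that contains exactly one pixel in each of its rows, let $j_{top}$ and $j_{bot}$ be the column indices of its pixel in its highest and lowest row, and let $\Delta(T)=(j_{top}-j_{bot}) \bmod w$. For integers $a,b$ let $\mathit{tran}_{a,b}(T)=\{p_{i+a,\,(j+b)\bmod w}\mid p_{ij}\in T\}$. Define $\mathcal{H}_0=\{\{p_{00}\},\{p_{01}\},\dots,\{p_{0,w-1}\}\}$ and, for $k=1,\dots,d$, $\mathcal{H}_k=\{T\cup \mathit{tran}_{2^{k-1},\,\Delta(T)+s}(T)\mid T\in\mathcal{H}_{k-1},\ s\in\{0,1\}\}$. For $h=2^d$ the set of FHT patterns is $\mathcal{H}_{h,w}=\mathcal{H}_d$. For a finite nonempty set $\mathcal{R}$ of pixel sets, its intersection area is $S(\mathcal{R})=|\mathcal{R}|\cdot\left|\bigcap_{T\in\mathcal{R}}T\right|$, and for a set $\mathcal{T}$ of pixel sets the self-intersection measure is $r(\mathcal{T})=\max_{\varnothing\neq\mathcal{R}\subseteq\mathcal{T}}S(\mathcal{R})$. -}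

module Defs where

open import Data.Nat using (ℕ; zero; suc; _+_; _*_; _^_; NonZero; _⊔_)
open import Data.Nat.Properties using () renaming (_≟_ to _≟ℕ_)
open import Data.Nat.DivMod using (_%_)
open import Data.Integer using (ℤ; +_; _-_)
open import Data.Integer.DivMod using (_%ℕ_)
open import Data.Product using (_×_; _,_; proj₁; proj₂)
open import Data.Product.Properties using (≡-dec)
open import Data.List using (List; []; _∷_; map; filter; length; concatMap; _++_; deduplicate; foldr)
open import Data.List.Membership.DecPropositional using (_∈?_)
open import Data.List.Relation.Unary.All using (all?)
open import Data.List.Relation.Unary.Any using (any?)
open import Relation.Binary.Definitions using (DecidableEquality)
open import Relation.Binary.PropositionalEquality using (_≡_)
open import Relation.Nullary using (Dec; _×-dec_)

-- A pixel p_{ij} is the pair (i , j): i = row (from the bottom), j = column.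
Pixel : Set
Pixel = ℕ × ℕ

_≟ₚ_ : DecidableEquality Pixel
_≟ₚ_ = ≡-dec _≟ℕ_ _≟ℕ_

-- A (finite) pixel set, represented by a list of its elements (order and
-- repetitions irrelevant; equality of pixel sets is `_≈ₛ_` below).
PixelSet : Set
PixelSet = List Pixel

_∈ₚ?_ : (p : Pixel) → (T : PixelSet) → Dec (Data.List.Membership.DecPropositional._∈_ _≟ₚ_ p T)
_∈ₚ?_ = _∈?_ _≟ₚ_

_⊆ₛ?_ : (T U : PixelSet) → Dec _
T ⊆ₛ? U = all? (λ p → p ∈ₚ? U) T

_≈ₛ?_ : (T U : PixelSet) → Dec _
T ≈ₛ? U = (T ⊆ₛ? U) ×-dec (U ⊆ₛ? T)

card : PixelSet → ℕ
card T = length (deduplicate _≟ₚ_ T)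

-- column index of the pixel in the highest / lowest row of T
-- (T has exactly one pixel in each of its rows; default 0 on the empty set)
topPix : PixelSet → Pixel
topPix [] = (0 , 0)
topPix (p ∷ []) = p
topPix (p ∷ q ∷ T) with topPix (q ∷ T)
... | t with Data.Nat._≤?_ (proj₁ p) (proj₁ t)
...   | Relation.Nullary.yes _ = t
...   | Relation.Nullary.no _ = p

botPix : PixelSet → Pixel
botPix [] = (0 , 0)
botPix (p ∷ []) = p
botPix (p ∷ q ∷ T) with botPix (q ∷ T)
... | t with Data.Nat._≤?_ (proj₁ p) (proj₁ t)
...   | Relation.Nullary.yes _ = p
...   | Relation.Nullary.no _ = t

Δ : (w : ℕ) .{{_ : NonZero w}} → PixelSet → ℕ
Δ w T = ((+ proj₂ (topPix T)) - (+ proj₂ (botPix T))) %ℕ w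

tran : (w : ℕ) .{{_ : NonZero w}} → ℕ → ℕ → PixelSet → PixelSet
tran w a b T = map (λ p → (proj₁ p + a , (proj₂ p + b) % w)) T

upTo : ℕ → List ℕ
upTo zero = []
upTo (suc n) = upTo n ++ (n ∷ [])

𝓗 : (w : ℕ) .{{_ : NonZero w}} → ℕ → List PixelSet
𝓗 w zero = map (λ j → ((0 , j) ∷ [])) (upTo w)
𝓗 w (suc k) =
  concatMap (λ T → map (λ s → T ++ tran w (2 ^ k) (Δ w T + s) T) (0 ∷ 1 ∷ []))
            (𝓗 w k)

FHT : (w : ℕ) .{{_ : NonZero w}} → (d : ℕ) → List PixelSet
FHT w d = 𝓗 w d

asSet : List PixelSet → List PixelSet
asSet = deduplicate _≈ₛ?_

⋂ : PixelSet → List PixelSet → PixelSet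
⋂ T [] = T
⋂ T (U ∷ R) = filter (λ p → p ∈ₚ? ⋂ U R) T

-- S(𝓡) = |𝓡| · |⋂ 𝓡|, for 𝓡 = T ∷ R a list of pairwise distinct sets
S : PixelSet → List PixelSet → ℕ
S T R = length (T ∷ R) * card (⋂ T R)

subs : {A : Set} → List A → List (List A)
subs [] = [] ∷ []
subs (x ∷ xs) = subs xs ++ map (x ∷_) (subs xs)

maxS : List (List PixelSet) → ℕ
maxS [] = 0
maxS ([] ∷ Rs) = maxS Rs
maxS ((T ∷ R) ∷ Rs) = S T R ⊔ maxS Rs

r : List PixelSet → ℕ
r 𝓣 = maxS (subs (asSet 𝓣))

module Submission where

-- A pattern of 𝓗_k has exactly one pixel in each of the rows 0 … 2^k − 1, so
-- it is described by its column function c (row i ↦ column c i).  Unfolding the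
-- recursion, c gives a pattern of 𝓗_{k+1} iff its lower half gives one of 𝓗_k
-- and its upper half is the lower half shifted cyclically by Δ + s for a bit
-- s ∈ {0,1} ('IsFHT', '𝓗⇒IsFHT').  Since Δ is invariant under cyclic shifts
-- ('Δₖ-shift-invariant') and Δ + 0 ≢ Δ + 1 mod w, patterns are rigid: a pattern
-- is determined by its bit and either half, and two patterns agreeing on one
-- half and in one pixel of the other half coincide.  By induction on k this
-- yields the counting bound: m pairwise different patterns of 𝓗_k with a
-- common set X of pixels satisfy m · |X| ≤ 2^k ('intersection-bound'); the
-- step splits X into its lower and upper pixels and the patterns by their bit.
-- Hence S(𝓡) ≤ 2^d for every subfamily 𝓡, while a single pattern has 2^d
-- pixels, so r = 2^d ('lemma1').

open import Defs
open import Data.Nat using (ℕ; zero; suc; _+_; _*_; _∸_; _^_; _≤_; _<_; z≤n; s≤s; NonZero)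
open import Data.Nat.Properties
open import Data.Nat.DivMod
open import Data.Integer using (-[1+_]; _-_) renaming (_+_ to _+ℤ_; +_ to pos)
import Data.Integer as ℤ
import Data.Integer.Properties as ℤ
open import Data.Integer.DivMod using (_%ℕ_)
open import Data.Sum using (_⊎_; inj₁; inj₂)
open import Data.Product using (∃; _×_; _,_; proj₁; proj₂)
open import Data.Empty using (⊥-elim)
open import Function using (_∘_)
open import Relation.Binary.PropositionalEquality
open import Relation.Nullary using (Dec; yes; no; ¬_; ¬?)
open import Relation.Unary using (Decidable)
open import Data.List using (List; []; _∷_; map; filter; length; _++_; deduplicate)
open import Data.List.Properties using (map-∘; map-cong; map-++; length-map; ++-assoc; length-++; ++-identityʳ; filter-all; map-cong-local)
open import Data.List.Membership.Propositional using (_∈_; find)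
open import Data.List.Membership.Propositional.Properties using (∈-map⁻; ∈-map⁺; ∈-++⁻; ∈-++⁺ˡ; ∈-++⁺ʳ; ∈-filter⁻; ∈-concatMap⁻; ∈-concatMap⁺; ∈-deduplicate⁻)
open import Data.List.Relation.Unary.Any using (here; there)
import Data.List.Relation.Unary.Any as Any
open import Data.List.Relation.Unary.Unique.DecPropositional.Properties using (deduplicate-!)
open import Data.List.Relation.Unary.All using (All; []; _∷_)
import Data.List.Relation.Unary.All as All
import Data.List.Relation.Unary.All.Properties as AllP
open import Data.List.Relation.Unary.AllPairs using (AllPairs; []; _∷_)
import Data.List.Relation.Unary.AllPairs as AllPairs
import Data.List.Relation.Unary.AllPairs.Properties as AllPairsP

∈upTo⇒< : ∀ {i} n → i ∈ upTo n → i < n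
∈upTo⇒< (suc n) i∈ with ∈-++⁻ (upTo n) i∈
... | inj₁ i∈n = m<n⇒m<1+n (∈upTo⇒< n i∈n)
... | inj₂ (here refl) = n<1+n n

<⇒∈upTo : ∀ {i} n → i < n → i ∈ upTo n
<⇒∈upTo {i} (suc n) i<1+n with i ≟ n
... | yes refl = ∈-++⁺ʳ (upTo n) (here refl)
... | no i≢n = ∈-++⁺ˡ (<⇒∈upTo n (≤∧≢⇒< (≤-pred i<1+n) i≢n))

length-upTo : ∀ n → length (upTo n) ≡ n
length-upTo zero = refl
length-upTo (suc n) = trans (length-++ (upTo n)) (trans (cong (_+ 1) (length-upTo n)) (+-comm n 1))

upTo-+ : ∀ m n → upTo (m + n) ≡ upTo m ++ map (m +_) (upTo n)
upTo-+ m zero = trans (cong upTo (+-identityʳ m)) (sym (++-identityʳ (upTo m)))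
upTo-+ m (suc n) = begin
    upTo (m + suc n)                                  ≡⟨ cong upTo (+-suc m n) ⟩
    upTo (m + n) ++ (m + n ∷ [])                      ≡⟨ cong (_++ (m + n ∷ [])) (upTo-+ m n) ⟩
    (upTo m ++ map (m +_) (upTo n)) ++ (m + n ∷ [])   ≡⟨ ++-assoc (upTo m) _ _ ⟩
    upTo m ++ (map (m +_) (upTo n) ++ (m + n ∷ []))   ≡⟨ cong (upTo m ++_) (sym (map-++ (m +_) (upTo n) (n ∷ []))) ⟩
    upTo m ++ map (m +_) (upTo (suc n))               ∎
  where open ≡-Reasoning

upTo-increasing : ∀ n → AllPairs _<_ (upTo n)
upTo-increasing zero = []
upTo-increasing (suc n) =
  AllPairsP.++⁺ (upTo-increasing n) ([] ∷ []) (All.tabulate (λ i∈ → ∈upTo⇒< n i∈ ∷ []))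

upTo-head : ∀ n → 0 < n → ∃ λ xs → upTo n ≡ 0 ∷ xs
upTo-head (suc zero) _ = [] , refl
upTo-head (suc (suc n)) _ with upTo-head (suc n) (s≤s z≤n)
... | xs , eq = xs ++ (suc n ∷ []) , cong (_++ (suc n ∷ [])) eq

2^-double : ∀ k → 2 ^ suc k ≡ 2 ^ k + 2 ^ k
2^-double k = cong (2 ^ k +_) (+-identityʳ (2 ^ k))

0<2^ : ∀ k → 0 < 2 ^ k
0<2^ k = m^n>0 2 k

lower-or-upper : ∀ h i → i < h + h → i < h ⊎ ∃ λ j → j < h × i ≡ h + j
lower-or-upper h i i<2h with i <? h
... | yes i<h = inj₁ i<h
... | no i≮h = inj₂ (i ∸ h , +-cancelˡ-< h (i ∸ h) h (subst (_< h + h) i≡ i<2h) , i≡)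
  where i≡ : i ≡ h + (i ∸ h)
        i≡ = sym (m+[n∸m]≡n (≮⇒≥ i≮h))

length-filter-split : ∀ {A : Set} {P : A → Set} (P? : Decidable P) xs →
  length xs ≡ length (filter P? xs) + length (filter (¬? ∘ P?) xs)
length-filter-split P? [] = refl
length-filter-split P? (x ∷ xs) with P? x
... | yes _ = cong suc (length-filter-split P? xs)
... | no _ = trans (cong suc (length-filter-split P? xs)) (sym (+-suc _ _))

some-member : ∀ {A : Set} (xs : List A) → 0 < length xs → ∃ λ x → x ∈ xs
some-member (x ∷ _) _ = x , here refl

AllPairs-map-with : ∀ {A : Set} {P : A → Set} {R S : A → A → Set} →
  (∀ {x y} → P x → P y → R x y → S x y) → ∀ {xs} → All P xs → AllPairs R xs → AllPairs S xs
AllPairs-map-with f [] [] = []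
AllPairs-map-with f (px ∷ pxs) (rx ∷ rxs) = All.zipWith (λ (py , r) → f px py r) (pxs , rx) ∷ AllPairs-map-with f pxs rxs

All⇒AllPairs : ∀ {A : Set} {P : A → Set} {R : A → A → Set} → (∀ {x y} → P x → P y → R x y) →
  ∀ {xs} → All P xs → AllPairs R xs
All⇒AllPairs f [] = []
All⇒AllPairs f (px ∷ pxs) = All.map (f px) pxs ∷ All⇒AllPairs f pxs

deduplicate-unrelated : ∀ {A : Set} {R : A → A → Set} (R? : ∀ x y → Dec (R x y)) xs →
  AllPairs (λ x y → ¬ R x y) (deduplicate R? xs)
deduplicate-unrelated R? [] = []
deduplicate-unrelated R? (x ∷ xs) =
  AllP.all-filter (¬? ∘ R? x) (deduplicate R? xs) ∷ AllPairsP.filter⁺ (¬? ∘ R? x) (deduplicate-unrelated R? xs)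

deduplicate-unique : ∀ (xs : List Pixel) → AllPairs (λ x y → ¬ x ≡ y) xs → deduplicate _≟ₚ_ xs ≡ xs
deduplicate-unique [] [] = refl
deduplicate-unique (x ∷ xs) (x∉ ∷ xs!) =
  cong (x ∷_) (trans (cong (filter (¬? ∘ (x ≟ₚ_))) (deduplicate-unique xs xs!)) (filter-all (¬? ∘ (x ≟ₚ_)) x∉))

subs-All : ∀ {A : Set} {Q : A → Set} {xs} ys → xs ∈ subs ys → All Q ys → All Q xs
subs-All [] (here refl) _ = []
subs-All (y ∷ ys) xs∈ (qy ∷ qys) with ∈-++⁻ (subs ys) xs∈
... | inj₁ xs∈′ = subs-All ys xs∈′ qys
... | inj₂ xs∈′ with ∈-map⁻ (y ∷_) xs∈′
...   | xs′ , xs′∈ , refl = qy ∷ subs-All ys xs′∈ qys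

subs-AllPairs : ∀ {A : Set} {R : A → A → Set} {xs} ys → xs ∈ subs ys → AllPairs R ys → AllPairs R xs
subs-AllPairs [] (here refl) _ = []
subs-AllPairs (y ∷ ys) xs∈ (ry ∷ rys) with ∈-++⁻ (subs ys) xs∈
... | inj₁ xs∈′ = subs-AllPairs ys xs∈′ rys
... | inj₂ xs∈′ with ∈-map⁻ (y ∷_) xs∈′
...   | xs′ , xs′∈ , refl = subs-All ys xs′∈ ry ∷ subs-AllPairs ys xs′∈ rys

head-singleton∈subs : ∀ {A : Set} (y : A) ys → (y ∷ []) ∈ subs (y ∷ ys)
head-singleton∈subs y ys = ∈-++⁺ʳ (subs ys) (∈-map⁺ (y ∷_) (empty∈subs ys))
  where
    empty∈subs : ∀ {A : Set} (ys : List A) → [] ∈ subs ys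
    empty∈subs [] = here refl
    empty∈subs (y ∷ ys) = ∈-++⁺ˡ (empty∈subs ys)

maxS-least : ∀ Rs B → (∀ {T R} → (T ∷ R) ∈ Rs → S T R ≤ B) → maxS Rs ≤ B
maxS-least [] B bound = z≤n
maxS-least ([] ∷ Rs) B bound = maxS-least Rs B (bound ∘ there)
maxS-least ((T ∷ R) ∷ Rs) B bound = ⊔-lub (bound (here refl)) (maxS-least Rs B (bound ∘ there))

maxS-upper : ∀ {T R} Rs → (T ∷ R) ∈ Rs → S T R ≤ maxS Rs
maxS-upper ([] ∷ Rs) (there TR∈) = maxS-upper Rs TR∈
maxS-upper ((T ∷ R) ∷ Rs) (here refl) = m≤m⊔n (S T R) (maxS Rs)
maxS-upper ((T ∷ R) ∷ Rs) (there TR∈) = ≤-trans (maxS-upper Rs TR∈) (m≤n⊔m (S T R) (maxS Rs))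

-- If every member of a nonempty family has n pixels, then r ≥ n: a single
-- member is a subfamily of intersection area n.
r-≥-member-size : ∀ {n} 𝓣 {T} → T ∈ 𝓣 → (∀ {U} → U ∈ 𝓣 → card U ≡ n) → n ≤ r 𝓣
r-≥-member-size (U ∷ 𝓣) _ size =
  subst (_≤ r (U ∷ 𝓣)) (trans (+-identityʳ (card U)) (size (here refl))) (maxS-upper _ (head-singleton∈subs U (filter (¬? ∘ (U ≈ₛ?_)) (asSet 𝓣))))

-- The arithmetic that closes the induction step of the counting bound:
-- m(a + b) ≤ 2h if each of m·a, m·b is at most 2h, and at most h as soon as
-- the other part is nonempty.
product-split-bound : ∀ m a b h → (0 < b → m * a ≤ h) → (0 < a → m * b ≤ h) →
  m * a ≤ h + h → m * b ≤ h + h → m * (a + b) ≤ h + h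
product-split-bound m zero b h _ _ _ mb≤ = mb≤
product-split-bound m (suc a) zero h _ _ ma≤ _ = subst (_≤ h + h) (cong (m *_) (sym (+-identityʳ (suc a)))) ma≤
product-split-bound m (suc a) (suc b) h ma≤ mb≤ _ _ =
  subst (_≤ h + h) (sym (*-distribˡ-+ m (suc a) (suc b))) (+-mono-≤ (ma≤ (s≤s z≤n)) (mb≤ (s≤s z≤n)))

higher lower : Pixel → Pixel → Pixel
higher p t with proj₁ p ≤? proj₁ t
... | yes _ = t
... | no _ = p
lower p t with proj₁ p ≤? proj₁ t
... | yes _ = p
... | no _ = t

topPix-∷ : ∀ p q T → topPix (p ∷ q ∷ T) ≡ higher p (topPix (q ∷ T))
topPix-∷ p q T with topPix (q ∷ T)
... | t with proj₁ p ≤? proj₁ t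
...   | yes _ = refl
...   | no _ = refl

botPix-∷ : ∀ p q T → botPix (p ∷ q ∷ T) ≡ lower p (botPix (q ∷ T))
botPix-∷ p q T with botPix (q ∷ T)
... | t with proj₁ p ≤? proj₁ t
...   | yes _ = refl
...   | no _ = refl

-- topPix / botPix only look at rows: changing the columns of the pixels of a
-- nonempty set (keeping rows) changes the chosen pixel in the same way.
module _ (f : Pixel → ℕ) where

  recolumn : Pixel → Pixel
  recolumn q = (proj₁ q , f q)

  higher-recolumn : ∀ p t → higher (recolumn p) (recolumn t) ≡ recolumn (higher p t)
  higher-recolumn p t with proj₁ p ≤? proj₁ t
  ... | yes _ = refl
  ... | no _ = refl

  lower-recolumn : ∀ p t → lower (recolumn p) (recolumn t) ≡ recolumn (lower p t)
  lower-recolumn p t with proj₁ p ≤? proj₁ t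
  ... | yes _ = refl
  ... | no _ = refl

  topPix-recolumn : ∀ p T → topPix (map recolumn (p ∷ T)) ≡ recolumn (topPix (p ∷ T))
  topPix-recolumn p [] = refl
  topPix-recolumn p (q ∷ T) = begin
    topPix (recolumn p ∷ recolumn q ∷ map recolumn T)   ≡⟨ topPix-∷ (recolumn p) (recolumn q) (map recolumn T) ⟩
    higher (recolumn p) (topPix (map recolumn (q ∷ T)))  ≡⟨ cong (higher (recolumn p)) (topPix-recolumn q T) ⟩
    higher (recolumn p) (recolumn (topPix (q ∷ T)))      ≡⟨ higher-recolumn p _ ⟩
    recolumn (higher p (topPix (q ∷ T)))                 ≡⟨ cong recolumn (sym (topPix-∷ p q T)) ⟩
    recolumn (topPix (p ∷ q ∷ T))                        ∎
    where open ≡-Reasoning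

  botPix-recolumn : ∀ p T → botPix (map recolumn (p ∷ T)) ≡ recolumn (botPix (p ∷ T))
  botPix-recolumn p [] = refl
  botPix-recolumn p (q ∷ T) = begin
    botPix (recolumn p ∷ recolumn q ∷ map recolumn T)   ≡⟨ botPix-∷ (recolumn p) (recolumn q) (map recolumn T) ⟩
    lower (recolumn p) (botPix (map recolumn (q ∷ T)))   ≡⟨ cong (lower (recolumn p)) (botPix-recolumn q T) ⟩
    lower (recolumn p) (recolumn (botPix (q ∷ T)))       ≡⟨ lower-recolumn p _ ⟩
    recolumn (lower p (botPix (q ∷ T)))                  ≡⟨ cong recolumn (sym (botPix-∷ p q T)) ⟩
    recolumn (botPix (p ∷ q ∷ T))                        ∎
    where open ≡-Reasoning

topPix∈ : ∀ p T → topPix (p ∷ T) ∈ (p ∷ T)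
topPix∈ p [] = here refl
topPix∈ p (q ∷ T) rewrite topPix-∷ p q T with proj₁ p ≤? proj₁ (topPix (q ∷ T))
... | yes _ = there (topPix∈ q T)
... | no _ = here refl

botPix∈ : ∀ p T → botPix (p ∷ T) ∈ (p ∷ T)
botPix∈ p [] = here refl
botPix∈ p (q ∷ T) rewrite botPix-∷ p q T with proj₁ p ≤? proj₁ (botPix (q ∷ T))
... | yes _ = here refl
... | no _ = there (botPix∈ q T)

module Mod (w : ℕ) .{{_ : NonZero w}} where

  %-+ˡ : ∀ a b → ((a % w) + b) % w ≡ (a + b) % w
  %-+ˡ a b = begin
    ((a % w) + b) % w            ≡⟨ %-distribˡ-+ (a % w) b w ⟩
    ((a % w % w) + (b % w)) % w  ≡⟨ cong (λ z → (z + (b % w)) % w) (m%n%n≡m%n a w) ⟩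
    ((a % w) + (b % w)) % w      ≡⟨ sym (%-distribˡ-+ a b w) ⟩
    (a + b) % w                  ∎
    where open ≡-Reasoning

  %-+ʳ : ∀ a b → (a + (b % w)) % w ≡ (a + b) % w
  %-+ʳ a b = trans (cong (_% w) (+-comm a (b % w))) (trans (%-+ˡ b a) (cong (_% w) (+-comm b a)))

  -- 'diff x y' is the residue of x − y modulo w, computed in ℕ.
  diff : ℕ → ℕ → ℕ
  diff x y = (x + (y * w ∸ y)) % w

  diff-+ : ∀ x y → (diff x y + y) % w ≡ x % w
  diff-+ x y = begin
    (diff x y + y) % w              ≡⟨ %-+ˡ (x + (y * w ∸ y)) y ⟩
    (x + (y * w ∸ y) + y) % w       ≡⟨ cong (_% w) (+-assoc x _ y) ⟩
    (x + ((y * w ∸ y) + y)) % w     ≡⟨ cong (λ t → (x + t) % w) (m∸n+n≡m (m≤m*n y w)) ⟩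
    (x + y * w) % w                 ≡⟨ [m+kn]%n≡m%n x y w ⟩
    x % w                           ∎
    where open ≡-Reasoning

  -- Adding the same number is injective on residues: subtract y back.
  +-cancel-% : ∀ z z′ y → z < w → z′ < w → (z + y) % w ≡ (z′ + y) % w → z ≡ z′
  +-cancel-% z z′ y z<w z′<w eq = begin
    z                             ≡⟨ sym (m<n⇒m%n≡m z<w) ⟩
    z % w                         ≡⟨ sym (subtract z) ⟩
    ((z + y) % w + (y * w ∸ y)) % w   ≡⟨ cong (λ t → (t + (y * w ∸ y)) % w) eq ⟩
    ((z′ + y) % w + (y * w ∸ y)) % w  ≡⟨ subtract z′ ⟩
    z′ % w                        ≡⟨ m<n⇒m%n≡m z′<w ⟩
    z′                            ∎
    where
      open ≡-Reasoning
      subtract : ∀ u → ((u + y) % w + (y * w ∸ y)) % w ≡ u % w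
      subtract u = begin
        ((u + y) % w + (y * w ∸ y)) % w  ≡⟨ %-+ˡ (u + y) (y * w ∸ y) ⟩
        (u + y + (y * w ∸ y)) % w        ≡⟨ cong (_% w) (+-assoc u y (y * w ∸ y)) ⟩
        (u + (y + (y * w ∸ y))) % w      ≡⟨ cong (λ t → (u + t) % w) (m+[n∸m]≡n (m≤m*n y w)) ⟩
        (u + y * w) % w                  ≡⟨ [m+kn]%n≡m%n u y w ⟩
        u % w                            ∎

  diff-shift : ∀ x y B → diff ((x + B) % w) ((y + B) % w) ≡ diff x y
  diff-shift x y B = +-cancel-% _ _ y′ (m%n<n _ w) (m%n<n _ w) (begin
    (diff ((x + B) % w) y′ + y′) % w  ≡⟨ diff-+ _ _ ⟩
    (x + B) % w % w                   ≡⟨ m%n%n≡m%n _ w ⟩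
    (x + B) % w                       ≡⟨ sym (%-+ˡ x B) ⟩
    (x % w + B) % w                   ≡⟨ cong (λ t → (t + B) % w) (sym (diff-+ x y)) ⟩
    ((diff x y + y) % w + B) % w      ≡⟨ %-+ˡ _ B ⟩
    (diff x y + y + B) % w            ≡⟨ cong (_% w) (+-assoc (diff x y) y B) ⟩
    (diff x y + (y + B)) % w          ≡⟨ sym (%-+ʳ (diff x y) (y + B)) ⟩
    (diff x y + y′) % w               ∎)
    where
      open ≡-Reasoning
      y′ = (y + B) % w

  -- Δ is defined through the integer residue (+ x − + y) mod w; it agrees
  -- with 'diff'.  First: adding multiples of w does not change a residue.
  private
    negative-residue : ℕ → ℕ
    negative-residue zero = 0
    negative-residue (suc r) = w ∸ suc r

    %ℕ-negative : ∀ n → -[1+ n ] %ℕ w ≡ negative-residue (suc n % w)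
    %ℕ-negative n with suc n % w
    ... | zero = refl
    ... | suc r = refl

  %ℕ-+w : ∀ i → (i +ℤ pos w) %ℕ w ≡ i %ℕ w
  %ℕ-+w (pos n) = [m+n]%n≡m%n n w
  %ℕ-+w -[1+ n ] with suc n ≤? w
  ... | yes 1+n≤w = trans (cong (_%ℕ w) (ℤ.⊖-≥ 1+n≤w)) (small (m≤n⇒m<n∨m≡n 1+n≤w))
    where
      small : suc n < w ⊎ suc n ≡ w → (w ∸ suc n) % w ≡ -[1+ n ] %ℕ w
      small (inj₁ 1+n<w) = trans (m<n⇒m%n≡m (∸-monoʳ-< {w} (s≤s z≤n) (≤-trans (n≤1+n _) 1+n<w)))
                             (sym (trans (%ℕ-negative n) (cong negative-residue (m<n⇒m%n≡m 1+n<w))))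
      small (inj₂ refl) = begin
        (suc n ∸ suc n) % suc n   ≡⟨ cong (_% suc n) (n∸n≡0 (suc n)) ⟩
        0                         ≡⟨ cong negative-residue (sym (n%n≡0 (suc n))) ⟩
        negative-residue (suc n % suc n) ≡⟨ sym (%ℕ-negative n) ⟩
        -[1+ n ] %ℕ suc n         ∎
        where open ≡-Reasoning
  ... | no 1+n≰w = begin
    (-[1+ n ] +ℤ pos w) %ℕ w                ≡⟨ cong (_%ℕ w) (ℤ.⊖-< (≰⇒> 1+n≰w)) ⟩
    (ℤ.- (pos (suc n ∸ w))) %ℕ w            ≡⟨ cong (λ t → (ℤ.- (pos t)) %ℕ w) (+-∸-assoc 1 w≤n) ⟩
    -[1+ (n ∸ w) ] %ℕ w                   ≡⟨ %ℕ-negative (n ∸ w) ⟩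
    negative-residue (suc (n ∸ w) % w)    ≡⟨ cong (λ t → negative-residue (t % w)) (sym (+-∸-assoc 1 w≤n)) ⟩
    negative-residue ((suc n ∸ w) % w)    ≡⟨ cong negative-residue (m≤n⇒[n∸m]%m≡n%m (m≤n⇒m≤1+n w≤n)) ⟩
    negative-residue (suc n % w)          ≡⟨ sym (%ℕ-negative n) ⟩
    -[1+ n ] %ℕ w                         ∎
    where
      open ≡-Reasoning
      w≤n : w ≤ n
      w≤n = ≤-pred (≰⇒> 1+n≰w)

  %ℕ-+multiple : ∀ k i → (i +ℤ pos (k * w)) %ℕ w ≡ i %ℕ w
  %ℕ-+multiple zero i = cong (_%ℕ w) (ℤ.+-identityʳ i)
  %ℕ-+multiple (suc k) i = begin
    (i +ℤ pos (w + k * w)) %ℕ w          ≡⟨ cong (λ t → (i +ℤ t) %ℕ w) (ℤ.pos-+ w (k * w)) ⟩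
    (i +ℤ (pos w +ℤ pos (k * w))) %ℕ w     ≡⟨ cong (λ t → (i +ℤ t) %ℕ w) (ℤ.+-comm (pos w) (pos (k * w))) ⟩
    (i +ℤ (pos (k * w) +ℤ pos w)) %ℕ w     ≡⟨ cong (_%ℕ w) (sym (ℤ.+-assoc i (pos (k * w)) (pos w))) ⟩
    ((i +ℤ pos (k * w)) +ℤ pos w) %ℕ w     ≡⟨ %ℕ-+w (i +ℤ pos (k * w)) ⟩
    (i +ℤ pos (k * w)) %ℕ w              ≡⟨ %ℕ-+multiple k i ⟩
    i %ℕ w                             ∎
    where open ≡-Reasoning

  %ℕ-diff : ∀ x y → (pos x - pos y) %ℕ w ≡ diff x y
  %ℕ-diff x y = begin
    (pos x - pos y) %ℕ w                     ≡⟨ sym (%ℕ-+multiple y (pos x - pos y)) ⟩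
    ((pos x - pos y) +ℤ pos (y * w)) %ℕ w      ≡⟨ cong (_%ℕ w) in-ℕ ⟩
    (pos (x + (y * w ∸ y))) %ℕ w           ∎
    where
      open ≡-Reasoning
      in-ℕ : (pos x - pos y) +ℤ pos (y * w) ≡ pos (x + (y * w ∸ y))
      in-ℕ = begin
        (pos x +ℤ ℤ.- pos y) +ℤ pos (y * w)    ≡⟨ ℤ.+-assoc (pos x) (ℤ.- pos y) (pos (y * w)) ⟩
        pos x +ℤ (ℤ.- pos y +ℤ pos (y * w))    ≡⟨ cong (pos x +ℤ_) (ℤ.+-comm (ℤ.- pos y) (pos (y * w))) ⟩
        pos x +ℤ (pos (y * w) +ℤ ℤ.- pos y)    ≡⟨ cong (pos x +ℤ_) (ℤ.m-n≡m⊖n (y * w) y) ⟩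
        pos x +ℤ ((y * w) ℤ.⊖ y)           ≡⟨ cong (pos x +ℤ_) (ℤ.⊖-≥ (m≤m*n y w)) ⟩
        pos x +ℤ pos (y * w ∸ y)             ≡⟨ sym (ℤ.pos-+ x (y * w ∸ y)) ⟩
        pos (x + (y * w ∸ y))              ∎

-- From now on w ≥ 2 is fixed.  A pattern with one pixel in each of the rows
-- 0 … 2^k − 1 is given by its column function c : row ↦ column.
module Patterns (w : ℕ) .{{_ : NonZero w}} (2≤w : 2 ≤ w) where
  open Mod w

  bit-injective : ∀ y s s′ → s ≤ 1 → s′ ≤ 1 → (y + s) % w ≡ (y + s′) % w → s ≡ s′
  bit-injective y .0 .0 z≤n z≤n _ = refl
  bit-injective y .0 .1 z≤n (s≤s z≤n) eq
    with +-cancel-% 0 1 y (≤-trans (s≤s z≤n) 2≤w) 2≤w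
           (trans (cong (_% w) (+-comm 0 y)) (trans eq (cong (_% w) (+-comm y 1))))
  ... | ()
  bit-injective y .1 .0 (s≤s z≤n) z≤n eq = sym (bit-injective y 0 1 z≤n (s≤s z≤n) (sym eq))
  bit-injective y .1 .1 (s≤s z≤n) (s≤s z≤n) _ = refl

  pixels : ℕ → (ℕ → ℕ) → PixelSet
  pixels k c = map (λ i → (i , c i)) (upTo (2 ^ k))

  skeleton : ℕ → PixelSet
  skeleton k = map (λ i → (i , 0)) (upTo (2 ^ k))

  Agree : ℕ → (ℕ → ℕ) → (ℕ → ℕ) → Set
  Agree k c c′ = ∀ i → i < 2 ^ k → c i ≡ c′ i

  pixels-cong : ∀ k c c′ → Agree k c c′ → pixels k c ≡ pixels k c′
  pixels-cong k c c′ c≗c′ = map-cong-local (All.tabulate (λ {i} i∈ → cong (i ,_) (c≗c′ i (∈upTo⇒< (2 ^ k) i∈))))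

  skeleton-∷ : ∀ k → ∃ λ T → skeleton k ≡ (0 , 0) ∷ T
  skeleton-∷ k with upTo-head (2 ^ k) (0<2^ k)
  ... | xs , eq = map (λ i → (i , 0)) xs , cong (map (λ i → (i , 0))) eq

  skeleton-rows : ∀ k {q} → q ∈ skeleton k → proj₁ q < 2 ^ k
  skeleton-rows k q∈ with ∈-map⁻ (λ i → (i , 0)) q∈
  ... | i , i∈ , refl = ∈upTo⇒< (2 ^ k) i∈

  -- The rows of the top and bottom pixel do not depend on the columns.
  topRow botRow : ℕ → ℕ
  topRow k = proj₁ (topPix (skeleton k))
  botRow k = proj₁ (botPix (skeleton k))

  extreme-row< : (pick : PixelSet → Pixel) → (∀ p T → pick (p ∷ T) ∈ (p ∷ T)) →
    ∀ k → proj₁ (pick (skeleton k)) < 2 ^ k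
  extreme-row< pick pick∈ k with skeleton-∷ k
  ... | T , eq rewrite eq = skeleton-rows k (subst (pick ((0 , 0) ∷ T) ∈_) (sym eq) (pick∈ (0 , 0) T))

  Δ-pixels : ∀ k c → Δ w (pixels k c) ≡ diff (c (topRow k)) (c (botRow k))
  Δ-pixels k c with skeleton-∷ k
  ... | T , eq = begin
    Δ w (pixels k c)                            ≡⟨ cong (Δ w) (map-∘ (upTo (2 ^ k))) ⟩
    Δ w (map (recolumn col) (skeleton k))       ≡⟨ cong (λ L → Δ w (map (recolumn col) L)) eq ⟩
    Δ w (map (recolumn col) ((0 , 0) ∷ T))      ≡⟨ cong₂ (λ a b → (pos (proj₂ a) - pos (proj₂ b)) %ℕ w)
                                                     (topPix-recolumn col (0 , 0) T) (botPix-recolumn col (0 , 0) T) ⟩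
    (pos (col (topPix ((0 , 0) ∷ T))) - pos (col (botPix ((0 , 0) ∷ T)))) %ℕ w  ≡⟨ %ℕ-diff (col (topPix ((0 , 0) ∷ T))) (col (botPix ((0 , 0) ∷ T))) ⟩
    diff (col (topPix ((0 , 0) ∷ T))) (col (botPix ((0 , 0) ∷ T)))           ≡⟨ cong (λ L → diff (col (topPix L)) (col (botPix L))) (sym eq) ⟩
    diff (c (topRow k)) (c (botRow k))          ∎
    where
      open ≡-Reasoning
      col : Pixel → ℕ
      col q = c (proj₁ q)

  Δₖ : ℕ → (ℕ → ℕ) → ℕ
  Δₖ k c = Δ w (pixels k c)

  Δₖ-cong : ∀ k c c′ → Agree k c c′ → Δₖ k c ≡ Δₖ k c′
  Δₖ-cong k c c′ c≗c′ = cong (Δ w) (pixels-cong k c c′ c≗c′)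

  Δₖ-shift-invariant : ∀ k c c′ B B′ → (∀ i → i < 2 ^ k → (c i + B) % w ≡ (c′ i + B′) % w) → Δₖ k c ≡ Δₖ k c′
  Δₖ-shift-invariant k c c′ B B′ shifted = begin
    Δₖ k c                                     ≡⟨ Δ-pixels k c ⟩
    diff (c t) (c b)                           ≡⟨ sym (diff-shift _ _ B) ⟩
    diff ((c t + B) % w) ((c b + B) % w)       ≡⟨ cong₂ diff (shifted t (extreme-row< topPix topPix∈ k))
                                                              (shifted b (extreme-row< botPix botPix∈ k)) ⟩
    diff ((c′ t + B′) % w) ((c′ b + B′) % w)   ≡⟨ diff-shift _ _ B′ ⟩
    diff (c′ t) (c′ b)                         ≡⟨ sym (Δ-pixels k c′) ⟩
    Δₖ k c′                                    ∎
    where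
      open ≡-Reasoning
      t = topRow k
      b = botRow k

  StepWith : ℕ → (ℕ → ℕ) → ℕ → Set
  StepWith k c s = ∀ i → i < 2 ^ k → c (2 ^ k + i) ≡ (c i + (Δₖ k c + s)) % w

  IsFHT : ℕ → (ℕ → ℕ) → Set
  IsFHT zero c = c 0 < w
  IsFHT (suc k) c = IsFHT k c × ∃ λ s → s ≤ 1 × StepWith k c s

  bitOf : ∀ {k c} → IsFHT (suc k) c → ℕ
  bitOf (_ , s , _) = s

  upper : ℕ → (ℕ → ℕ) → ℕ → ℕ
  upper k c j = c (2 ^ k + j)

  lower<2^ : ∀ k {i} → i < 2 ^ k → i < 2 ^ suc k
  lower<2^ k {i} i< = subst (i <_) (sym (2^-double k)) (≤-trans i< (m≤m+n (2 ^ k) (2 ^ k)))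

  upper<2^ : ∀ k {j} → j < 2 ^ k → 2 ^ k + j < 2 ^ suc k
  upper<2^ k {j} j< = subst (2 ^ k + j <_) (sym (2^-double k)) (+-monoʳ-< (2 ^ k) j<)

  IsFHT-column< : ∀ k c → IsFHT k c → ∀ i → i < 2 ^ k → c i < w
  IsFHT-column< zero c c0<w zero _ = c0<w
  IsFHT-column< zero c _ (suc i) (s≤s ())
  IsFHT-column< (suc k) c (fht , s , _ , step) i i< with lower-or-upper (2 ^ k) i (subst (i <_) (2^-double k) i<)
  ... | inj₁ i<h = IsFHT-column< k c fht i i<h
  ... | inj₂ (j , j< , refl) = subst (_< w) (sym (step j j<)) (m%n<n (c j + (Δₖ k c + s)) w)

  IsFHT-cong : ∀ k c c′ → Agree k c c′ → IsFHT k c → IsFHT k c′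
  IsFHT-cong zero c c′ c≗c′ c0<w = subst (_< w) (c≗c′ 0 (s≤s z≤n)) c0<w
  IsFHT-cong (suc k) c c′ c≗c′ (fht , s , s≤1 , step) = IsFHT-cong k c c′ lower≗ fht , s , s≤1 , step′
    where
      lower≗ : Agree k c c′
      lower≗ i i< = c≗c′ i (lower<2^ k i<)
      step′ : StepWith k c′ s
      step′ i i< = begin
        c′ (2 ^ k + i)             ≡⟨ sym (c≗c′ _ (upper<2^ k i<)) ⟩
        c (2 ^ k + i)              ≡⟨ step i i< ⟩
        (c i + (Δₖ k c + s)) % w   ≡⟨ cong₂ (λ a b → (a + (b + s)) % w) (lower≗ i i<) (Δₖ-cong k c c′ lower≗) ⟩
        (c′ i + (Δₖ k c′ + s)) % w ∎
        where open ≡-Reasoning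

  shift : (ℕ → ℕ) → ℕ → ℕ → ℕ
  shift c a i = (c i + a) % w

  IsFHT-shift : ∀ k c a → IsFHT k c → IsFHT k (shift c a)
  IsFHT-shift zero c a _ = m%n<n _ w
  IsFHT-shift (suc k) c a (fht , s , s≤1 , step) = IsFHT-shift k c a fht , s , s≤1 , step′
    where
      sameΔ : Δₖ k c ≡ Δₖ k (shift c a)
      sameΔ = Δₖ-shift-invariant k c (shift c a) a 0
                (λ i _ → sym (trans (cong (_% w) (+-identityʳ _)) (m%n%n≡m%n _ w)))
      step′ : StepWith k (shift c a) s
      step′ i i< = begin
        (c (2 ^ k + i) + a) % w                   ≡⟨ cong (λ t → (t + a) % w) (step i i<) ⟩
        ((c i + (Δₖ k c + s)) % w + a) % w        ≡⟨ %-+ˡ _ a ⟩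
        (c i + (Δₖ k c + s) + a) % w              ≡⟨ cong (_% w) (+-assoc (c i) _ a) ⟩
        (c i + ((Δₖ k c + s) + a)) % w            ≡⟨ cong (λ t → (c i + t) % w) (+-comm _ a) ⟩
        (c i + (a + (Δₖ k c + s))) % w            ≡⟨ cong (_% w) (sym (+-assoc (c i) a _)) ⟩
        (c i + a + (Δₖ k c + s)) % w              ≡⟨ sym (%-+ˡ _ _) ⟩
        ((c i + a) % w + (Δₖ k c + s)) % w        ≡⟨ cong (λ t → ((c i + a) % w + (t + s)) % w) sameΔ ⟩
        ((c i + a) % w + (Δₖ k (shift c a) + s)) % w ∎
        where open ≡-Reasoning

  IsFHT-upper : ∀ k c → IsFHT (suc k) c → IsFHT k (upper k c)
  IsFHT-upper k c (fht , s , _ , step) =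
    IsFHT-cong k (shift c (Δₖ k c + s)) (upper k c) (λ i i< → sym (step i i<)) (IsFHT-shift k c _ fht)

  -- Rigidity of FHT patterns.

  same-upper⇒same-Δ : ∀ k c c′ → IsFHT (suc k) c → IsFHT (suc k) c′ →
    Agree k (upper k c) (upper k c′) → Δₖ k c ≡ Δₖ k c′
  same-upper⇒same-Δ k c c′ (_ , s , _ , step) (_ , s′ , _ , step′) upper≗ =
    Δₖ-shift-invariant k c c′ (Δₖ k c + s) (Δₖ k c′ + s′)
      (λ i i< → trans (sym (step i i<)) (trans (upper≗ i i<) (step′ i i<)))

  same-bit-from-row : ∀ k c c′ (g : IsFHT (suc k) c) (g′ : IsFHT (suc k) c′) j → j < 2 ^ k →
    c j ≡ c′ j → Δₖ k c ≡ Δₖ k c′ → upper k c j ≡ upper k c′ j → bitOf g ≡ bitOf g′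
  same-bit-from-row k c c′ (_ , s , s≤1 , step) (_ , s′ , s′≤1 , step′) j j< cj≡ Δ≡ upper≡ =
    bit-injective (c j + Δₖ k c) s s′ s≤1 s′≤1 (begin
      (c j + Δₖ k c + s) % w       ≡⟨ cong (_% w) (+-assoc (c j) _ s) ⟩
      (c j + (Δₖ k c + s)) % w     ≡⟨ sym (step j j<) ⟩
      c (2 ^ k + j)                ≡⟨ upper≡ ⟩
      c′ (2 ^ k + j)               ≡⟨ step′ j j< ⟩
      (c′ j + (Δₖ k c′ + s′)) % w  ≡⟨ cong₂ (λ a b → (a + (b + s′)) % w) (sym cj≡) (sym Δ≡) ⟩
      (c j + (Δₖ k c + s′)) % w    ≡⟨ cong (_% w) (sym (+-assoc (c j) _ s′)) ⟩
      (c j + Δₖ k c + s′) % w      ∎)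
    where open ≡-Reasoning

  same-bit-lower⇒agree : ∀ k c c′ (g : IsFHT (suc k) c) (g′ : IsFHT (suc k) c′) →
    bitOf g ≡ bitOf g′ → Agree k c c′ → Agree (suc k) c c′
  same-bit-lower⇒agree k c c′ (_ , s , _ , step) (_ , s′ , _ , step′) s≡s′ lower≗ i i<
    with lower-or-upper (2 ^ k) i (subst (i <_) (2^-double k) i<)
  ... | inj₁ i<h = lower≗ i i<h
  ... | inj₂ (j , j< , refl) =
    trans (step j j<) (trans (cong₂ (λ a b → (a + b) % w) (lower≗ j j<) (cong₂ _+_ (Δₖ-cong k c c′ lower≗) s≡s′))
                             (sym (step′ j j<)))

  -- Upper half and bit determine the lower half: undo the shift by Δ + s.
  same-bit-upper⇒agree : ∀ k c c′ (g : IsFHT (suc k) c) (g′ : IsFHT (suc k) c′) →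
    bitOf g ≡ bitOf g′ → Agree k (upper k c) (upper k c′) → Agree (suc k) c c′
  same-bit-upper⇒agree k c c′ g@(fht , s , _ , step) g′@(fht′ , s′ , _ , step′) s≡s′ upper≗ =
    same-bit-lower⇒agree k c c′ g g′ s≡s′ lower≗
    where
      lower≗ : Agree k c c′
      lower≗ i i< = +-cancel-% (c i) (c′ i) (Δₖ k c + s)
        (IsFHT-column< k c fht i i<) (IsFHT-column< k c′ fht′ i i<)
        (trans (sym (step i i<)) (trans (upper≗ i i<) (trans (step′ i i<)
          (cong₂ (λ a b → (c′ i + (a + b)) % w) (sym (same-upper⇒same-Δ k c c′ g g′ upper≗)) (sym s≡s′)))))

  lower+upper-row⇒agree : ∀ k c c′ → IsFHT (suc k) c → IsFHT (suc k) c′ →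
    Agree k c c′ → (∃ λ j → j < 2 ^ k × upper k c j ≡ upper k c′ j) → Agree (suc k) c c′
  lower+upper-row⇒agree k c c′ g g′ lower≗ (j , j< , upper≡) =
    same-bit-lower⇒agree k c c′ g g′ (same-bit-from-row k c c′ g g′ j j< (lower≗ j j<) (Δₖ-cong k c c′ lower≗) upper≡) lower≗

  upper+lower-row⇒agree : ∀ k c c′ → IsFHT (suc k) c → IsFHT (suc k) c′ →
    Agree k (upper k c) (upper k c′) → (∃ λ j → j < 2 ^ k × c j ≡ c′ j) → Agree (suc k) c c′
  upper+lower-row⇒agree k c c′ g g′ upper≗ (j , j< , cj≡) =
    same-bit-upper⇒agree k c c′ g g′
      (same-bit-from-row k c c′ g g′ j j< cj≡ (same-upper⇒same-Δ k c c′ g g′ upper≗) (upper≗ j j<)) upper≗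

  -- The bit of a pattern of 𝓗_{k+1} is 0 exactly when row 2^k is row 0
  -- shifted by Δ; this makes "having bit 0" decidable.
  HasBit0 : ℕ → (ℕ → ℕ) → Set
  HasBit0 k c = upper k c 0 ≡ (c 0 + (Δₖ k c + 0)) % w

  hasBit0? : ∀ k → Decidable (HasBit0 k)
  hasBit0? k c = upper k c 0 ≟ (c 0 + (Δₖ k c + 0)) % w

  SameBit : ℕ → (ℕ → ℕ) → (ℕ → ℕ) → Set
  SameBit k c c′ = (g : IsFHT (suc k) c) (g′ : IsFHT (suc k) c′) → bitOf g ≡ bitOf g′

  bit≡0 : ∀ k c (g : IsFHT (suc k) c) → HasBit0 k c → bitOf g ≡ 0
  bit≡0 k c (_ , s , s≤1 , step) bit0 = bit-injective (c 0 + Δₖ k c) s 0 s≤1 z≤n (begin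
    (c 0 + Δₖ k c + s) % w    ≡⟨ cong (_% w) (+-assoc (c 0) _ s) ⟩
    (c 0 + (Δₖ k c + s)) % w  ≡⟨ sym (step 0 (0<2^ k)) ⟩
    upper k c 0               ≡⟨ bit0 ⟩
    (c 0 + (Δₖ k c + 0)) % w  ≡⟨ cong (_% w) (sym (+-assoc (c 0) _ 0)) ⟩
    (c 0 + Δₖ k c + 0) % w    ∎)
    where open ≡-Reasoning

  bit≡1 : ∀ k c (g : IsFHT (suc k) c) → ¬ HasBit0 k c → bitOf g ≡ 1
  bit≡1 k c (_ , .0 , z≤n , step) ¬bit0 = ⊥-elim (¬bit0 (step 0 (0<2^ k)))
  bit≡1 k c (_ , .1 , s≤s z≤n , _) _ = refl

  split-by-bit : ∀ k (Fs : List (ℕ → ℕ)) n h →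
    (∀ {Q : (ℕ → ℕ) → Set} (Q? : Decidable Q) → AllPairs (SameBit k) (filter Q? Fs) → length (filter Q? Fs) * n ≤ h) →
    length Fs * n ≤ h + h
  split-by-bit k Fs n h class-bound = begin
    length Fs * n                          ≡⟨ cong (_* n) (length-filter-split (hasBit0? k) Fs) ⟩
    (length bit0 + length bit1) * n        ≡⟨ *-distribʳ-+ n (length bit0) (length bit1) ⟩
    length bit0 * n + length bit1 * n      ≤⟨ +-mono-≤ (class-bound (hasBit0? k) same0) (class-bound (¬? ∘ hasBit0? k) same1) ⟩
    h + h                                  ∎
    where
      open ≤-Reasoning
      bit0 = filter (hasBit0? k) Fs
      bit1 = filter (¬? ∘ hasBit0? k) Fs
      same0 : AllPairs (SameBit k) bit0
      same0 = All⇒AllPairs (λ {c} {c′} b b′ g g′ → trans (bit≡0 k c g b) (sym (bit≡0 k c′ g′ b′)))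
                (AllP.all-filter (hasBit0? k) Fs)
      same1 : AllPairs (SameBit k) bit1
      same1 = All⇒AllPairs (λ {c} {c′} b b′ g g′ → trans (bit≡1 k c g b) (sym (bit≡1 k c′ g′ b′)))
                (AllP.all-filter (¬? ∘ hasBit0? k) Fs)

  OnPattern : ℕ → ℕ → (ℕ → ℕ) → Pixel → Set
  OnPattern v k c p = ∃ λ i → i < 2 ^ k × p ≡ (v + i , c i)

  common-row : ∀ {v k c c′ p} → OnPattern v k c p → OnPattern v k c′ p → ∃ λ i → i < 2 ^ k × c i ≡ c′ i
  common-row {v} (i , i< , refl) (i′ , _ , eq) with +-cancelˡ-≡ v i i′ (cong proj₁ eq)
  ... | refl = i , i< , cong proj₂ eq

  on-lower-half : ∀ {v k c p} → OnPattern v (suc k) c p → proj₁ p < v + 2 ^ k → OnPattern v k c p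
  on-lower-half {v} {k} (i , _ , refl) low = i , +-cancelˡ-< v i (2 ^ k) low , refl

  on-upper-half : ∀ {v k c p} → OnPattern v (suc k) c p → ¬ proj₁ p < v + 2 ^ k → OnPattern (v + 2 ^ k) k (upper k c) p
  on-upper-half {v} {k} {c} (i , i< , refl) ¬low with lower-or-upper (2 ^ k) i (subst (i <_) (2^-double k) i<)
  ... | inj₁ i<h = ⊥-elim (¬low (+-monoʳ-< v i<h))
  ... | inj₂ (j , j< , refl) = j , j< , cong (_, c (2 ^ k + j)) (sym (+-assoc v (2 ^ k) j))

  record Shared (k v : ℕ) (Fs : List (ℕ → ℕ)) (X : List Pixel) : Set where
    field
      fht      : All (IsFHT k) Fs
      distinct : AllPairs (λ c c′ → ¬ Agree k c c′) Fs
      unique   : AllPairs (λ p q → ¬ p ≡ q) X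
      common   : ∀ {p} → p ∈ X → All (λ c → OnPattern v k c p) Fs

  Bound : ℕ → Set
  Bound k = ∀ v Fs X → Shared k v Fs X → length Fs * length X ≤ 2 ^ k

  -- With a single row, two patterns sharing a pixel coincide and a pattern has one pixel.
  bound-base : Bound 0
  bound-base v [] X _ = z≤n
  bound-base v (c ∷ []) [] _ = z≤n
  bound-base v (c ∷ []) (p ∷ []) _ = s≤s z≤n
  bound-base v (c ∷ []) (p ∷ q ∷ X) sh with Shared.common sh (here refl) | Shared.common sh (there (here refl)) | Shared.unique sh
  ... | on ∷ [] | on′ ∷ [] | (p≢q ∷ _) ∷ _ = ⊥-elim (p≢q (trans (only-pixel on) (sym (only-pixel on′))))
    where
      only-pixel : ∀ {p} → OnPattern v 0 c p → p ≡ (v + 0 , c 0)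
      only-pixel (zero , _ , eq) = eq
      only-pixel (suc _ , s≤s () , _)
  bound-base v (c ∷ c′ ∷ Fs) [] _ = subst (_≤ 1) (sym (*-zeroʳ (length (c ∷ c′ ∷ Fs)))) z≤n
  bound-base v (c ∷ c′ ∷ Fs) (p ∷ X) sh with Shared.common sh (here refl) | Shared.distinct sh
  ... | on ∷ on′ ∷ _ | (c≉c′ ∷ _) ∷ _ with common-row {v} {0} {c} {c′} on on′
  ...   | zero , _ , c0≡ = ⊥-elim (c≉c′ λ { zero _ → c0≡ ; (suc i) (s≤s ()) })
  ...   | suc _ , s≤s () , _

  via-lower-halves : ∀ {k v Gs Y} → Bound k → All (IsFHT (suc k)) Gs → AllPairs (λ c c′ → ¬ Agree k c c′) Gs →
    AllPairs (λ p q → ¬ p ≡ q) Y → (∀ {p} → p ∈ Y → All (λ c → OnPattern v k c p) Gs) → length Gs * length Y ≤ 2 ^ k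
  via-lower-halves ih fht distinct unique common =
    ih _ _ _ record { fht = All.map proj₁ fht ; distinct = distinct ; unique = unique ; common = common }

  via-upper-halves : ∀ {k v Gs Y} → Bound k → All (IsFHT (suc k)) Gs →
    AllPairs (λ c c′ → ¬ Agree k (upper k c) (upper k c′)) Gs → AllPairs (λ p q → ¬ p ≡ q) Y →
    (∀ {p} → p ∈ Y → All (λ c → OnPattern v k (upper k c) p) Gs) → length Gs * length Y ≤ 2 ^ k
  via-upper-halves {k} {Gs = Gs} {Y} ih fht distinct unique common =
    subst (λ m → m * length Y ≤ 2 ^ k) (length-map (upper k) Gs)
      (ih _ _ _ record { fht = AllP.map⁺ (All.map (IsFHT-upper k _) fht) ; distinct = AllPairsP.map⁺ distinct
                       ; unique = unique ; common = AllP.map⁺ ∘ common })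

  -- Split X into the pixels XL in the
  -- lower and XH in the upper half.  If XH is nonempty, the patterns have
  -- pairwise different lower halves (rigidity), so |Fs|·|XL| ≤ h by induction;
  -- symmetrically for XL.  In any case, within one bit class the lower halves
  -- and the upper halves are pairwise different, so |Fs|·|XL|, |Fs|·|XH| ≤ 2h.
  bound-step : ∀ k → Bound k → Bound (suc k)
  bound-step k ih v Fs X sh =
    subst₂ _≤_ (cong (length Fs *_) (sym (length-filter-split low? X))) (sym (2^-double k))
      (product-split-bound (length Fs) (length XL) (length XH) h
        lower-if-upper-shared upper-if-lower-shared lower-by-bit upper-by-bit)
    where
      open Shared sh
      h = 2 ^ k
      low? : Decidable (λ (p : Pixel) → proj₁ p < v + h)
      low? p = proj₁ p <? v + h
      XL = filter low? X
      XH = filter (¬? ∘ low?) X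

      commonL : ∀ {p} → p ∈ XL → All (λ c → OnPattern v k c p) Fs
      commonL p∈ with ∈-filter⁻ low? p∈
      ... | p∈X , low = All.map (λ on → on-lower-half {k = k} on low) (common p∈X)

      commonH : ∀ {p} → p ∈ XH → All (λ c → OnPattern (v + h) k (upper k c) p) Fs
      commonH p∈ with ∈-filter⁻ (¬? ∘ low?) p∈
      ... | p∈X , ¬low = All.map (λ on → on-upper-half {k = k} on ¬low) (common p∈X)

      lower-if-upper-shared : 0 < length XH → length Fs * length XL ≤ h
      lower-if-upper-shared XH≠[] with some-member XH XH≠[]
      ... | q , q∈ = via-lower-halves ih fht
        (AllPairs-map-with (λ (g , on) (g′ , on′) c≉c′ lower≗ →
                              c≉c′ (lower+upper-row⇒agree k _ _ g g′ lower≗ (common-row {k = k} on on′)))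
                           (All.zip (fht , commonH q∈)) distinct)
        (AllPairsP.filter⁺ low? unique) commonL

      upper-if-lower-shared : 0 < length XL → length Fs * length XH ≤ h
      upper-if-lower-shared XL≠[] with some-member XL XL≠[]
      ... | q , q∈ = via-upper-halves ih fht
        (AllPairs-map-with (λ (g , on) (g′ , on′) c≉c′ upper≗ →
                              c≉c′ (upper+lower-row⇒agree k _ _ g g′ upper≗ (common-row {k = k} on on′)))
                           (All.zip (fht , commonL q∈)) distinct)
        (AllPairsP.filter⁺ (¬? ∘ low?) unique) commonH

      lower-by-bit : length Fs * length XL ≤ h + h
      lower-by-bit = split-by-bit k Fs (length XL) h (λ Q? same → via-lower-halves ih (AllP.filter⁺ Q? fht)
        (AllPairs-map-with (λ g g′ (same-bit , c≉c′) lower≗ → c≉c′ (same-bit-lower⇒agree k _ _ g g′ (same-bit g g′) lower≗))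
                           (AllP.filter⁺ Q? fht) (AllPairs.zip (same , AllPairsP.filter⁺ Q? distinct)))
        (AllPairsP.filter⁺ low? unique) (AllP.filter⁺ Q? ∘ commonL))

      upper-by-bit : length Fs * length XH ≤ h + h
      upper-by-bit = split-by-bit k Fs (length XH) h (λ Q? same → via-upper-halves ih (AllP.filter⁺ Q? fht)
        (AllPairs-map-with (λ g g′ (same-bit , c≉c′) upper≗ → c≉c′ (same-bit-upper⇒agree k _ _ g g′ (same-bit g g′) upper≗))
                           (AllP.filter⁺ Q? fht) (AllPairs.zip (same , AllPairsP.filter⁺ Q? distinct)))
        (AllPairsP.filter⁺ (¬? ∘ low?) unique) (AllP.filter⁺ Q? ∘ commonH))

  intersection-bound : ∀ k → Bound k
  intersection-bound zero = bound-base
  intersection-bound (suc k) = bound-step k (intersection-bound k)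

  -- Column functions of the patterns of 𝓗_k.  The pattern T ++ tran(T) of
  -- 𝓗_{k+1} has as column function c on the lower half, glued with the
  -- shifted columns on the upper half.
  glue : ℕ → (ℕ → ℕ) → (ℕ → ℕ) → ℕ → ℕ
  glue h c d i with i <? h
  ... | yes _ = c i
  ... | no _ = d (i ∸ h)

  glue-lower : ∀ h c d i → i < h → glue h c d i ≡ c i
  glue-lower h c d i i<h with i <? h
  ... | yes _ = refl
  ... | no i≮h = ⊥-elim (i≮h i<h)

  glue-upper : ∀ h c d j → glue h c d (h + j) ≡ d j
  glue-upper h c d j with h + j <? h
  ... | yes h+j<h = ⊥-elim (<-irrefl refl (≤-trans h+j<h (m≤m+n h j)))
  ... | no _ = cong d (m+n∸m≡n h j)

  pixels-glue : ∀ k c d → pixels (suc k) (glue (2 ^ k) c d) ≡ pixels k c ++ map (λ i → (2 ^ k + i) , d i) (upTo (2 ^ k))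
  pixels-glue k c d = begin
    map row (upTo (2 ^ suc k))                         ≡⟨ cong (map row ∘ upTo) (2^-double k) ⟩
    map row (upTo (h + h))                             ≡⟨ cong (map row) (upTo-+ h h) ⟩
    map row (upTo h ++ map (h +_) (upTo h))            ≡⟨ map-++ row (upTo h) _ ⟩
    map row (upTo h) ++ map row (map (h +_) (upTo h))  ≡⟨ cong₂ _++_ lower-half (sym (map-∘ (upTo h))) ⟩
    pixels k c ++ map (row ∘ (h +_)) (upTo h)          ≡⟨ cong (pixels k c ++_) (map-cong (λ j → cong (h + j ,_) (glue-upper h c d j)) (upTo h)) ⟩
    pixels k c ++ map (λ i → (h + i) , d i) (upTo h)   ∎
    where
      open ≡-Reasoning
      h = 2 ^ k
      row : ℕ → Pixel
      row i = (i , glue h c d i)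
      lower-half : map row (upTo h) ≡ pixels k c
      lower-half = map-cong-local (All.tabulate (λ {i} i∈ → cong (i ,_) (glue-lower h c d i (∈upTo⇒< h i∈))))

  𝓗⇒IsFHT : ∀ k T → T ∈ 𝓗 w k → ∃ λ c → IsFHT k c × T ≡ pixels k c
  𝓗⇒IsFHT zero T T∈ with ∈-map⁻ (λ j → ((0 , j) ∷ [])) T∈
  ... | j , j∈ , refl = (λ _ → j) , ∈upTo⇒< w j∈ , refl
  𝓗⇒IsFHT (suc k) T T∈
    with find (∈-concatMap⁻ (λ T → map (λ s → T ++ tran w (2 ^ k) (Δ w T + s) T) (0 ∷ 1 ∷ [])) {xs = 𝓗 w k} T∈)
  ... | T₀ , T₀∈ , T∈children with 𝓗⇒IsFHT k T₀ T₀∈ | ∈-map⁻ (λ s → T₀ ++ tran w (2 ^ k) (Δ w T₀ + s) T₀) T∈children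
  ... | c , fht , refl | s , s∈ , refl = c′ , (IsFHT-cong k c c′ lower≗ fht , s , bit≤1 s∈ , step) , sym glued
    where
      h = 2 ^ k
      b = Δ w (pixels k c) + s
      c′ = glue h c (λ j → (c j + b) % w)
      lower≗ : Agree k c c′
      lower≗ i i< = sym (glue-lower h c _ i i<)
      bit≤1 : ∀ {s} → s ∈ (0 ∷ 1 ∷ []) → s ≤ 1
      bit≤1 (here refl) = z≤n
      bit≤1 (there (here refl)) = s≤s z≤n
      step : StepWith k c′ s
      step i i< = trans (glue-upper h c _ i)
        (cong₂ (λ a d → (a + (d + s)) % w) (lower≗ i i<) (Δₖ-cong k c c′ lower≗))
      glued : pixels (suc k) c′ ≡ pixels k c ++ tran w h b (pixels k c)
      glued = trans (pixels-glue k c _) (cong (pixels k c ++_)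
                (trans (map-cong (λ i → cong₂ _,_ (+-comm h i) refl) (upTo h)) (map-∘ (upTo h))))

  -- A pattern of 𝓗_k has exactly 2^k pixels, one in each row.
  card-pixels : ∀ k c → card (pixels k c) ≡ 2 ^ k
  card-pixels k c = begin
    length (deduplicate _≟ₚ_ (pixels k c))   ≡⟨ cong length (deduplicate-unique (pixels k c) rows-distinct) ⟩
    length (pixels k c)                      ≡⟨ length-map (λ i → (i , c i)) (upTo (2 ^ k)) ⟩
    length (upTo (2 ^ k))                    ≡⟨ length-upTo (2 ^ k) ⟩
    2 ^ k                                    ∎
    where
      open ≡-Reasoning
      rows-distinct : AllPairs (λ p q → ¬ p ≡ q) (pixels k c)
      rows-distinct = AllPairsP.map⁺ (AllPairs.map (λ i<j eq → <-irrefl (cong proj₁ eq) i<j) (upTo-increasing (2 ^ k)))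

  𝓗-inhabited : ∀ k → ∃ λ T → T ∈ 𝓗 w k
  𝓗-inhabited zero = ((0 , 0) ∷ []) , ∈-map⁺ (λ j → ((0 , j) ∷ [])) (<⇒∈upTo w (≤-trans (s≤s z≤n) 2≤w))
  𝓗-inhabited (suc k) with 𝓗-inhabited k
  ... | T , T∈ = T ++ tran w (2 ^ k) (Δ w T + 0) T ,
        ∈-concatMap⁺ (λ T → map (λ s → T ++ tran w (2 ^ k) (Δ w T + s) T) (0 ∷ 1 ∷ [])) {xs = 𝓗 w k}
          (Any.map (λ { refl → here refl }) T∈)

  ⋂-common : ∀ {p} T R → p ∈ ⋂ T R → All (p ∈_) (T ∷ R)
  ⋂-common T [] p∈ = p∈ ∷ []
  ⋂-common T (U ∷ R) p∈ with ∈-filter⁻ (λ p → p ∈ₚ? ⋂ U R) {xs = T} p∈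
  ... | p∈T , p∈⋂ = p∈T ∷ ⋂-common U R p∈⋂

  columns-of : ∀ k L → All (_∈ 𝓗 w k) L → ∃ λ Fs → All (IsFHT k) Fs × L ≡ map (pixels k) Fs
  columns-of k [] [] = [] , [] , refl
  columns-of k (T ∷ L) (T∈ ∷ L∈) with 𝓗⇒IsFHT k T T∈ | columns-of k L L∈
  ... | c , fht , refl | Fs , fhts , refl = c ∷ Fs , fht ∷ fhts , refl

  SameSet : PixelSet → PixelSet → Set
  SameSet T U = All (_∈ U) T × All (_∈ T) U

  different-sets⇒different-columns : ∀ k Fs → AllPairs (λ T U → ¬ SameSet T U) (map (pixels k) Fs) →
    AllPairs (λ c c′ → ¬ Agree k c c′) Fs
  different-sets⇒different-columns k Fs different =
    AllPairs.map (λ {c} {c′} ¬same c≗c′ → ¬same (subst (SameSet (pixels k c)) (pixels-cong k c c′ c≗c′) (⊆-refl , ⊆-refl)))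
      (AllPairsP.map⁻ different)
    where
      ⊆-refl : ∀ {T} → All (_∈ T) T
      ⊆-refl = All.tabulate (λ p∈ → p∈)

  ∈pixels⇒OnPattern : ∀ {k c p} → p ∈ pixels k c → OnPattern 0 k c p
  ∈pixels⇒OnPattern {k} {c} p∈ with ∈-map⁻ (λ i → (i , c i)) p∈
  ... | i , i∈ , eq = i , ∈upTo⇒< (2 ^ k) i∈ , eq

  subfamily-bound : ∀ d {T R} → (T ∷ R) ∈ subs (asSet (𝓗 w d)) → S T R ≤ 2 ^ d
  subfamily-bound d {T} {R} 𝓡∈ with columns-of d (T ∷ R) (subs-All (asSet (𝓗 w d)) 𝓡∈ (AllP.deduplicate⁺ _≈ₛ?_ (All.tabulate (λ T∈ → T∈))))
  ... | Fs , fht , 𝓡≡ =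
    subst (λ m → m * length X ≤ 2 ^ d) (trans (sym (length-map (pixels d) Fs)) (cong length (sym 𝓡≡)))
      (intersection-bound d 0 Fs X record
        { fht = fht
        ; distinct = different-sets⇒different-columns d Fs (subst (AllPairs _) 𝓡≡ different)
        ; unique = deduplicate-! _≟ₚ_ (⋂ T R)
        ; common = on-all })
    where
      X = deduplicate _≟ₚ_ (⋂ T R)
      on-all : ∀ {p} → p ∈ X → All (λ c → OnPattern 0 d c p) Fs
      on-all {p} p∈ = All.map (∈pixels⇒OnPattern {d}) (AllP.map⁻
        (subst (All (p ∈_)) 𝓡≡ (⋂-common T R (∈-deduplicate⁻ _≟ₚ_ (⋂ T R) p∈))))
      different : AllPairs (λ T U → ¬ SameSet T U) (T ∷ R)
      different = subs-AllPairs (asSet (𝓗 w d)) 𝓡∈ (deduplicate-unrelated _≈ₛ?_ (𝓗 w d))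

lemma1 : (w : ℕ) .{{_ : NonZero w}} → 2 ≤ w → (d : ℕ) →
    r (FHT w d) ≡ 2 ^ d
lemma1 w 2≤w d = ≤-antisym
  (maxS-least (subs (asSet (𝓗 w d))) (2 ^ d) (subfamily-bound d))
  (r-≥-member-size (𝓗 w d) (proj₂ (𝓗-inhabited d)) pattern-size)
  where
    open Patterns w 2≤w
    pattern-size : ∀ {T} → T ∈ 𝓗 w d → card T ≡ 2 ^ d
    pattern-size {T} T∈ with 𝓗⇒IsFHT d T T∈
    ... | c , _ , refl = card-pixels d c
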